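{- If a graph $G$ is competitively tight, then $|\overline{E}_{\triangle}(G)| \geq |V(G)| - \theta_E(E_{\triangle}(G); G) - 2$.
   Context: All graphs are finite, simple and undirected. The competition graph $C(D)$ of a digraph $D$ is the graph with vertex set $V(D)$ in which distinct $x,y$ are adjacent iff there is a vertex $v$ with $(x,v),(y,v)$ both arcs of $D$. The competition number $k(G)$ is the minimum integer $k\ge 0$ such that $G$ together with $k$ new isolated vertices is the competition graph of an acyclic digraph. A clique of $G$ is a vertex subset inducing a complete graph; an edge is covered by a clique if both endpoints lie in it. $\theta_E(G)$ is the minimum size of a family of cliques covering all edges of $G$, and $G$ is competitively tight if $k(G)=\theta_E(G)-|V(G)|+2$. For $F\subseteq E(G)$, $\theta_E(F;G)$ is the minimum size of a family of cliques of $G$ covering every edge in $F$. $E_{\triangle}(G)$ is the set of edges contained in some triangle of $G$, and $\overline{E}_{\triangle}(G)=E(G)\setminus E_{\triangle}(G)$. -}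

module Defs where

open import Data.Nat using (ℕ; _+_; _≤_; _<_)
open import Data.Fin using (Fin; _↑ˡ_; toℕ)
open import Data.Fin.Subset using (Subset; _∈_)
open import Data.Bool using (Bool; true; false; _∧_; not)
open import Data.List using (List; length; filterᵇ; concatMap; allFin)
open import Data.Bool.ListAction using (any)
open import Data.List.Membership.Propositional renaming (_∈_ to _∈ₗ_)
open import Data.Product using (Σ; ∃; _×_; _,_)
open import Data.Empty using (⊥)
open import Relation.Nullary using (¬_)
open import Relation.Binary.PropositionalEquality using (_≡_; _≢_)
open import Data.Fin.Properties using (_<?_)
open import Relation.Nullary.Decidable using (⌊_⌋)

record Graph (n : ℕ) : Set where
  field
    adj   : Fin n → Fin n → Bool
    sym   : ∀ i j → adj i j ≡ adj j i
    irref : ∀ i → adj i i ≡ false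
open Graph public

IsMin : (ℕ → Set) → ℕ → Set
IsMin P k = P k × (∀ j → P j → k ≤ j)

Digraph : ℕ → Set₁
Digraph m = Fin m → Fin m → Set

data Reach {m : ℕ} (A : Digraph m) : Fin m → Fin m → Set where
  step : ∀ {x y} → A x y → Reach A x y
  _▸_  : ∀ {x y z} → A x y → Reach A y z → Reach A x z

Acyclic : ∀ {m} → Digraph m → Set
Acyclic A = ∀ v → ¬ Reach A v v

-- adjacency of G together with k new isolated vertices (vertices n..n+k-1)
ExtAdj : ∀ {n} → Graph n → (k : ℕ) → Fin (n + k) → Fin (n + k) → Set
ExtAdj {n} G k x y =
  Σ (Fin n) λ i → Σ (Fin n) λ j →
    (x ≡ i ↑ˡ k) × (y ≡ j ↑ˡ k) × (adj G i j ≡ true)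

IsCompetitionGraphOf : ∀ {m} → (Fin m → Fin m → Set) → Digraph m → Set
IsCompetitionGraphOf H A =
  ∀ x y → x ≢ y →
    (H x y → ∃ λ v → A x v × A y v) × ((∃ λ v → A x v × A y v) → H x y)

CompRealizable : ∀ {n} → Graph n → ℕ → Set₁
CompRealizable {n} G k =
  Σ (Digraph (n + k)) λ A → Acyclic A × IsCompetitionGraphOf (ExtAdj G k) A

IsCompetitionNumber : ∀ {n} → Graph n → ℕ → Set₁
IsCompetitionNumber G k =
  CompRealizable G k × (∀ j → CompRealizable G j → k ≤ j)

IsClique : ∀ {n} → Graph n → Subset n → Set
IsClique G C = ∀ i j → i ∈ C → j ∈ C → i ≢ j → adj G i j ≡ true

-- an edge set, given as a (symmetric) predicate on vertex pairs
EdgeSet : ℕ → Set₁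
EdgeSet n = Fin n → Fin n → Set

CoversEdges : ∀ {n} → Graph n → EdgeSet n → List (Subset n) → Set
CoversEdges G F 𝓒 =
  (∀ C → C ∈ₗ 𝓒 → IsClique G C) ×
  (∀ i j → F i j → ∃ λ C → C ∈ₗ 𝓒 × i ∈ C × j ∈ C)

CoverableWith : ∀ {n} → Graph n → EdgeSet n → ℕ → Set
CoverableWith G F t = ∃ λ 𝓒 → CoversEdges G F 𝓒 × length 𝓒 ≡ t

IsThetaE : ∀ {n} → Graph n → EdgeSet n → ℕ → Set
IsThetaE G F t = IsMin (CoverableWith G F) t

AllEdges : ∀ {n} → Graph n → EdgeSet n
AllEdges G i j = adj G i j ≡ true

-- edge {i,j} lies in a triangle (as a boolean; meaningful when adj i j)
inTriangle : ∀ {n} → Graph n → Fin n → Fin n → Bool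
inTriangle {n} G i j = any (λ k → adj G i k ∧ adj G j k) (allFin n)

TriEdges : ∀ {n} → Graph n → EdgeSet n
TriEdges G i j = (adj G i j ≡ true) × (inTriangle G i j ≡ true)

-- |Ē_△(G)|: number of pairs i < j with ij an edge in no triangle
nonTriEdgeCount : ∀ {n} → Graph n → ℕ
nonTriEdgeCount {n} G =
  length (filterᵇ (λ p → ⌊ Data.Product.proj₁ p <? Data.Product.proj₂ p ⌋ ∧
                        (adj G (Data.Product.proj₁ p) (Data.Product.proj₂ p) ∧
                         not (inTriangle G (Data.Product.proj₁ p) (Data.Product.proj₂ p))))
                 (concatMap (λ i → Data.List.map (λ j → (i , j)) (allFin n)) (allFin n)))
  where import Data.Product
        import Data.List

-- Competitive tightness: k(G) = θ_E(G) − |V(G)| + 2  (as integers)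

CompetitivelyTight : ∀ {n} → Graph n → Set₁
CompetitivelyTight {n} G =
  Σ ℕ λ k → Σ ℕ λ θ →
    IsCompetitionNumber G k × IsThetaE G (AllEdges G) θ × (k + n ≡ θ + 2)

module Submission where

-- Take an optimal clique family covering E_△(G) (t cliques) and add,
-- for every edge outside all triangles, the two-element clique formed by
-- its endpoints.  This covers all of E(G) with |Ē_△(G)| + t cliques, so
--     θ_E(G) ≤ |Ē_△(G)| + θ_E(E_△(G); G).
-- Competitive tightness says k(G) + |V(G)| = θ_E(G) + 2, and since
-- k(G) ≥ 0 this gives |V(G)| ≤ θ_E(G) + 2; combining both inequalities
-- yields the theorem.

open import Defs
open import Data.Nat using (ℕ; _+_; _≤_)
open import Data.Nat.Properties using (m≤n+m; +-monoˡ-≤; module ≤-Reasoning)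
open import Data.Fin using (Fin; _<_)
open import Data.Fin.Properties using (_<?_; <-cmp)
open import Data.Fin.Subset using (Subset; ⁅_⁆; _∪_) renaming (_∈_ to _∈ₛ_)
open import Data.Fin.Subset.Properties using (x∈⁅x⁆; x∈⁅y⁆⇒x≡y; x∈p∪q⁻; p⊆p∪q; q⊆p∪q)
open import Data.Bool using (Bool; true; false; T; T?; _∧_; not)
open import Data.Bool.ListAction using (or)
open import Data.Bool.Properties using (∧-comm; T-≡; T-not-≡; T-∧)
open import Data.List using (List; length; filterᵇ; concatMap; allFin; map; _++_)
open import Data.List.Properties using (length-++; length-map; map-cong)
open import Data.List.Membership.Propositional using () renaming (_∈_ to _∈ₗ_)
open import Data.List.Membership.Propositional.Properties
  using (∈-allFin; ∈-map⁺; ∈-map⁻; ∈-++⁺ˡ; ∈-++⁺ʳ; ∈-++⁻; ∈-concatMap⁺; ∈-filter⁺; ∈-filter⁻)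
import Data.List.Relation.Unary.Any as Any
open import Data.Product using (∃; _×_; _,_; proj₁; proj₂)
open import Data.Sum using (_⊎_; inj₁; inj₂)
import Data.Sum as Sum
open import Data.Empty using (⊥-elim)
open import Function using (_∘_)
open import Function.Bundles using (Equivalence)
open import Relation.Nullary.Decidable using (⌊_⌋; fromWitness)
open import Relation.Binary using (tri<; tri≈; tri>)
open import Relation.Binary.PropositionalEquality
  using (_≡_; _≢_; refl; trans; cong; cong₂; module ≡-Reasoning) renaming (sym to ≡-sym)

open Equivalence using (to; from)

module _ {n : ℕ} (G : Graph n) where

  edgeClique : ∀ {a b} → adj G a b ≡ true → IsClique G (⁅ a ⁆ ∪ ⁅ b ⁆)
  edgeClique {a} {b} ab x y x∈ y∈ = endpoints (members x∈) (members y∈)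
    where
    members : ∀ {z} → z ∈ₛ ⁅ a ⁆ ∪ ⁅ b ⁆ → z ≡ a ⊎ z ≡ b
    members = Sum.map (x∈⁅y⁆⇒x≡y a) (x∈⁅y⁆⇒x≡y b) ∘ x∈p∪q⁻ ⁅ a ⁆ ⁅ b ⁆

    endpoints : ∀ {x y} → x ≡ a ⊎ x ≡ b → y ≡ a ⊎ y ≡ b → x ≢ y → adj G x y ≡ true
    endpoints (inj₁ refl) (inj₁ refl) x≢y = ⊥-elim (x≢y refl)
    endpoints (inj₁ refl) (inj₂ refl) _   = ab
    endpoints (inj₂ refl) (inj₁ refl) _   = trans (Graph.sym G b a) ab
    endpoints (inj₂ refl) (inj₂ refl) x≢y = ⊥-elim (x≢y refl)

  coverAppend : ∀ {F F′ H : EdgeSet n} {𝓒 𝓓 : List (Subset n)} →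
    CoversEdges G F 𝓒 → CoversEdges G F′ 𝓓 →
    (∀ i j → H i j → F i j ⊎ F′ i j) → CoversEdges G H (𝓒 ++ 𝓓)
  coverAppend {𝓒 = 𝓒} (cliques₁ , covers₁) (cliques₂ , covers₂) H⊆F∪F′ =
    cliques , covers
    where
    cliques : ∀ C → C ∈ₗ 𝓒 ++ _ → IsClique G C
    cliques C C∈ with ∈-++⁻ 𝓒 C∈
    ... | inj₁ C∈𝓒 = cliques₁ C C∈𝓒
    ... | inj₂ C∈𝓓 = cliques₂ C C∈𝓓

    covers : ∀ i j → _ → ∃ λ C → C ∈ₗ 𝓒 ++ _ × i ∈ₛ C × j ∈ₛ C
    covers i j h with H⊆F∪F′ i j h
    ... | inj₁ f with C , C∈ , i∈ , j∈ ← covers₁ i j f = C , ∈-++⁺ˡ C∈ , i∈ , j∈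
    ... | inj₂ f with C , C∈ , i∈ , j∈ ← covers₂ i j f = C , ∈-++⁺ʳ 𝓒 C∈ , i∈ , j∈

  pairSet : Fin n × Fin n → Subset n
  pairSet (a , b) = ⁅ a ⁆ ∪ ⁅ b ⁆

  Listed : List (Fin n × Fin n) → EdgeSet n
  Listed L i j = (i , j) ∈ₗ L ⊎ (j , i) ∈ₗ L

  edgeCliquesCover : (L : List (Fin n × Fin n)) →
    (∀ {a b} → (a , b) ∈ₗ L → adj G a b ≡ true) →
    CoversEdges G (Listed L) (map pairSet L)
  edgeCliquesCover L edges = cliques , covers
    where
    cliques : ∀ C → C ∈ₗ map pairSet L → IsClique G C
    cliques C C∈ with (a , b) , ab∈ , refl ← ∈-map⁻ pairSet C∈ = edgeClique (edges ab∈)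

    covers : ∀ i j → Listed L i j → ∃ λ C → C ∈ₗ map pairSet L × i ∈ₛ C × j ∈ₛ C
    covers i j (inj₁ ij∈) =
      pairSet (i , j) , ∈-map⁺ pairSet ij∈ , p⊆p∪q ⁅ j ⁆ (x∈⁅x⁆ i) , q⊆p∪q ⁅ i ⁆ ⁅ j ⁆ (x∈⁅x⁆ j)
    covers i j (inj₂ ji∈) =
      pairSet (j , i) , ∈-map⁺ pairSet ji∈ , q⊆p∪q ⁅ j ⁆ ⁅ i ⁆ (x∈⁅x⁆ i) , p⊆p∪q ⁅ i ⁆ (x∈⁅x⁆ j)

  inTriangle-sym : ∀ i j → inTriangle G i j ≡ inTriangle G j i
  inTriangle-sym i j =
    cong or (map-cong (λ k → ∧-comm (adj G i k) (adj G j k)) (allFin n))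

  isNonTriEdge : Fin n × Fin n → Bool
  isNonTriEdge (i , j) = ⌊ i <? j ⌋ ∧ (adj G i j ∧ not (inTriangle G i j))

  -- All ordered vertex pairs, in the enumeration used by nonTriEdgeCount.
  allPairs : List (Fin n × Fin n)
  allPairs = concatMap (λ i → map (λ j → (i , j)) (allFin n)) (allFin n)

  nonTriEdges : List (Fin n × Fin n)
  nonTriEdges = filterᵇ isNonTriEdge allPairs

  ∈-allPairs : ∀ i j → (i , j) ∈ₗ allPairs
  ∈-allPairs i j = ∈-concatMap⁺ (λ i → map (λ j → (i , j)) (allFin n))
    (Any.map (λ { refl → ∈-map⁺ (i ,_) (∈-allFin j) }) (∈-allFin i))

  nonTriEdges-edge : ∀ {a b} → (a , b) ∈ₗ nonTriEdges → adj G a b ≡ true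
  nonTriEdges-edge {a} {b} ab∈ =
    to T-≡ (proj₁ (to (T-∧ {adj G a b}) (proj₂ (to (T-∧ {⌊ a <? b ⌋}) listed))))
    where
    listed : T (isNonTriEdge (a , b))
    listed = proj₂ (∈-filter⁻ (T? ∘ isNonTriEdge) {xs = allPairs} ab∈)

  nonTriEdges-complete : ∀ {i j} → i < j → adj G i j ≡ true → inTriangle G i j ≡ false →
    (i , j) ∈ₗ nonTriEdges
  nonTriEdges-complete {i} {j} i<j ij notTri =
    ∈-filter⁺ (T? ∘ isNonTriEdge) (∈-allPairs i j) listed
    where
    listed : T (isNonTriEdge (i , j))
    listed = from (T-∧ {⌊ i <? j ⌋}) (fromWitness i<j ,
               from (T-∧ {adj G i j}) (from T-≡ ij , from T-not-≡ notTri))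

  edgeDichotomy : ∀ i j → AllEdges G i j → TriEdges G i j ⊎ Listed nonTriEdges i j
  edgeDichotomy i j ij = byTriangle (inTriangle G i j) refl
    where
    byTriangle : ∀ b → inTriangle G i j ≡ b → TriEdges G i j ⊎ Listed nonTriEdges i j
    byTriangle true  tri = inj₁ (ij , tri)
    byTriangle false tri with <-cmp i j
    ... | tri< i<j _ _ = inj₂ (inj₁ (nonTriEdges-complete i<j ij tri))
    ... | tri≈ _ refl _ with () ← trans (≡-sym ij) (irref G i)
    ... | tri> _ _ j<i =
      inj₂ (inj₂ (nonTriEdges-complete j<i (trans (Graph.sym G j i) ij)
                                           (trans (inTriangle-sym j i) tri)))

  coverAllEdges : ∀ {t} → CoverableWith G (TriEdges G) t →
    CoverableWith G (AllEdges G) (nonTriEdgeCount G + t)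
  coverAllEdges {t} (𝓒 , covers𝓒 , |𝓒|≡t) =
    map pairSet nonTriEdges ++ 𝓒 ,
    coverAppend (edgeCliquesCover nonTriEdges nonTriEdges-edge) covers𝓒 swapDichotomy ,
    size
    where
    swapDichotomy : ∀ i j → AllEdges G i j → Listed nonTriEdges i j ⊎ TriEdges G i j
    swapDichotomy i j = Sum.swap ∘ edgeDichotomy i j

    size : length (map pairSet nonTriEdges ++ 𝓒) ≡ nonTriEdgeCount G + t
    size = begin
      length (map pairSet nonTriEdges ++ 𝓒)          ≡⟨ length-++ (map pairSet nonTriEdges) ⟩
      length (map pairSet nonTriEdges) + length 𝓒     ≡⟨ cong₂ _+_ (length-map pairSet nonTriEdges) |𝓒|≡t ⟩
      nonTriEdgeCount G + t                           ∎
      where open ≡-Reasoning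

  tightCoverBound : CompetitivelyTight G → ∀ c → CoverableWith G (AllEdges G) c → n ≤ c + 2
  tightCoverBound (k , θ , _ , (_ , θ-minimal) , k+n≡θ+2) c coverable = begin
    n      ≤⟨ m≤n+m n k ⟩
    k + n  ≡⟨ k+n≡θ+2 ⟩
    θ + 2  ≤⟨ +-monoˡ-≤ 2 (θ-minimal c coverable) ⟩
    c + 2  ∎
    where open ≤-Reasoning

mainTheorem11 : ∀ {n} (G : Graph n) → CompetitivelyTight G →
    ∀ t → IsThetaE G (TriEdges G) t →
    n ≤ nonTriEdgeCount G + t + 2
mainTheorem11 G tight t (coverable , _) =
  tightCoverBound G tight (nonTriEdgeCount G + t) (coverAllEdges G coverable)
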